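{- Let $\mathbf L=\langle L,\land,\lor,',0,1\rangle$ be a De Morgan bisemilattice. For $x\in L$ put $\uparrow x=\{F\in\mathcal F(L):x\in F\}$ and $\downarrow x=\{I\in\mathcal I(L):x\notin I\}$. Let $X=\{\uparrow x:x\in L\}$ and $Y=\{\downarrow x:x\in L\}$, and define $\theta(\uparrow x)=\downarrow x$ and $(\downarrow x)^\star=\uparrow(x')$. Then: - $X$ is closed under finite intersections and $Y$ under finite unions; - $Y$ has least element $\overline 0=\downarrow 0$; - $\theta:X\to Y$ and ${}^\star:Y\to X$ are well-defined bijections satisfying all the conditions of a DDBS of sets. Hence $\langle X,\cdot,+,{}^\dagger,\bot,\top\rangle$ is a DDBS of sets, and it is isomorphic to $\mathbf L$.
   Context: **Bisemilattices.** A distributive bisemilattice is an algebra $\langle A,\land,\lor\rangle$ in which both operations are idempotent, commutative and associative and each distributes over the other. Write $a\le_\land b$ iff $a\land b=a$, and $a\le_\lor b$ iff $a\lor b=b$. A De Morgan bisemilattice is an algebra $\langle A,\land,\lor,',0,1\rangle$ such that $\langle A,\land,\lor\rangle$ is a distributive bisemilattice, and $x\land1=x$, $x\lor0=x$, $x''=x$, $(x\land y)'=x'\lor y'$, $(x\lor y)'=x'\land y'$. A filter is a nonempty subset that is upward closed for $\le_\land$ and closed under $\land$. An ideal is a nonempty subset that is downward closed for $\le_\lor$ and closed under $\lor$. $\mathcal F(L)$ and $\mathcal I(L)$ denote the sets of filters and ideals. **DDBS of sets.** Let $X$ be a family of sets closed under finite intersections and $Y$ a family of sets closed under finite unions with a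 least element $\overline 0$. Let $\theta:X\to Y$ be a bijection such that: - for all $A,B,C\in X$: $A\cap\theta^{ -1}(\theta(B)\cup\theta(C))=\theta^{ -1}(\theta(A\cap B)\cup\theta(A\cap C))$; - for all $P,Q,R\in Y$: $P\cup\theta(\theta^{ -1}(Q)\cap\theta^{ -1}(R))=\theta(\theta^{ -1}(P\cup Q)\cap\theta^{ -1}(P\cup R))$. Let ${}^\star:Y\to X$ be an inclusion-reversing order isomorphism with ${}^\star\circ\theta=\theta^{ -1}\circ({}^\star)^{ -1}$. For $A,B\in X$ define: $A+B=\theta^{ -1}(\theta(A)\cup\theta(B))$, $A\cdot B=A\cap B$, $A^\dagger=(\theta(A))^\star$, $\bot=\theta^{ -1}(\overline0)$, $\top=\overline0^\star$. The resulting structure $\langle X,\cdot,+,{}^\dagger,\bot,\top\rangle$ is called a DDBS of sets. -}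

module Defs where

open import Level using (Level; _⊔_; Lift; lift) renaming (suc to lsuc)
open import Data.Product using (Σ; ∃; _×_; _,_)
open import Data.Sum using (_⊎_)
open import Relation.Binary.PropositionalEquality using (_≡_)
open import Relation.Nullary using (¬_)

record DeMorganBisemilattice (a : Level) : Set (lsuc a) where
  infixr 7 _∧_
  infixr 6 _∨_
  infix 8 _′
  field
    Carrier : Set a
    _∧_ _∨_ : Carrier → Carrier → Carrier
    _′      : Carrier → Carrier
    0# 1#   : Carrier
    ∧-idem   : ∀ x → x ∧ x ≡ x
    ∧-comm   : ∀ x y → x ∧ y ≡ y ∧ x
    ∧-assoc  : ∀ x y z → (x ∧ y) ∧ z ≡ x ∧ (y ∧ z)
    ∨-idem   : ∀ x → x ∨ x ≡ x
    ∨-comm   : ∀ x y → x ∨ y ≡ y ∨ x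
    ∨-assoc  : ∀ x y z → (x ∨ y) ∨ z ≡ x ∨ (y ∨ z)
    ∧-distrib-∨ : ∀ x y z → x ∧ (y ∨ z) ≡ (x ∧ y) ∨ (x ∧ z)
    ∨-distrib-∧ : ∀ x y z → x ∨ (y ∧ z) ≡ (x ∨ y) ∧ (x ∨ z)
    ∧-identity : ∀ x → x ∧ 1# ≡ x
    ∨-identity : ∀ x → x ∨ 0# ≡ x
    ′-invol    : ∀ x → x ′ ′ ≡ x
    deMorgan-∧ : ∀ x y → (x ∧ y) ′ ≡ x ′ ∨ y ′
    deMorgan-∨ : ∀ x y → (x ∨ y) ′ ≡ x ′ ∧ y ′

  _≤∧_ : Carrier → Carrier → Set a
  x ≤∧ y = x ∧ y ≡ x

  _≤∨_ : Carrier → Carrier → Set a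
  x ≤∨ y = x ∨ y ≡ y

module _ {a : Level} (L : DeMorganBisemilattice a) where
  open DeMorganBisemilattice L

  record Filter : Set (lsuc a) where
    field
      P        : Carrier → Set a
      nonempty : ∃ λ x → P x
      up       : ∀ {x y} → P x → x ≤∧ y → P y
      meet     : ∀ {x y} → P x → P y → P (x ∧ y)

  record Ideal : Set (lsuc a) where
    field
      P        : Carrier → Set a
      nonempty : ∃ λ x → P x
      down     : ∀ {x y} → P y → x ≤∨ y → P x
      join     : ∀ {x y} → P x → P y → P (x ∨ y)

Subset : ∀ {u} → Set u → (ℓ : Level) → Set (u ⊔ lsuc ℓ)
Subset U ℓ = U → Set ℓ

module _ {u ℓ : Level} {U : Set u} where
  infix 4 _⊆_ _≐_
  infixr 7 _∩_
  infixr 6 _∪_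

  _⊆_ : Subset U ℓ → Subset U ℓ → Set (u ⊔ ℓ)
  A ⊆ B = ∀ z → A z → B z

  _≐_ : Subset U ℓ → Subset U ℓ → Set (u ⊔ ℓ)
  A ≐ B = (A ⊆ B) × (B ⊆ A)

  _∩_ : Subset U ℓ → Subset U ℓ → Subset U ℓ
  (A ∩ B) z = A z × B z

  _∪_ : Subset U ℓ → Subset U ℓ → Subset U ℓ
  (A ∪ B) z = A z ⊎ B z

-- X is a family of subsets of U, Y a family of subsets of V (families are
-- predicates on subsets).  θ, θ⁻¹, ⋆ (called star) and its inverse star⁻¹
-- are given as functions on subsets; only their behaviour on members of
-- X resp. Y matters.

record DDBSData {u v : Level} (U : Set u) (V : Set v) (ℓ m : Level)
       : Set (u ⊔ v ⊔ lsuc ℓ ⊔ lsuc m) where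
  field
    X     : Subset U ℓ → Set m
    Y     : Subset V ℓ → Set m
    θ     : Subset U ℓ → Subset V ℓ
    θ⁻¹   : Subset V ℓ → Subset U ℓ
    star  : Subset V ℓ → Subset U ℓ
    star⁻¹ : Subset U ℓ → Subset V ℓ
    0̄     : Subset V ℓ

  _+_ : Subset U ℓ → Subset U ℓ → Subset U ℓ
  A + B = θ⁻¹ (θ A ∪ θ B)

  _·_ : Subset U ℓ → Subset U ℓ → Subset U ℓ
  A · B = A ∩ B

  _† : Subset U ℓ → Subset U ℓ
  A † = star (θ A)

  ⊥ₛ : Subset U ℓ
  ⊥ₛ = θ⁻¹ 0̄

  ⊤ₛ : Subset U ℓ
  ⊤ₛ = star 0̄

record IsDDBSofSets {u v ℓ m : Level} {U : Set u} {V : Set v}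
       (D : DDBSData U V ℓ m) : Set (u ⊔ v ⊔ lsuc ℓ ⊔ m) where
  open DDBSData D
  field
    X-resp : ∀ {A B} → A ≐ B → X A → X B
    Y-resp : ∀ {P Q} → P ≐ Q → Y P → Y Q
    X-∩ : ∀ {A B} → X A → X B → X (A ∩ B)
    Y-∪ : ∀ {P Q} → Y P → Y Q → Y (P ∪ Q)
    Y-0̄     : Y 0̄
    0̄-least : ∀ {P} → Y P → 0̄ ⊆ P
    θ-Y      : ∀ {A} → X A → Y (θ A)
    θ-resp   : ∀ {A B} → X A → X B → A ≐ B → θ A ≐ θ B
    θ⁻¹-X    : ∀ {P} → Y P → X (θ⁻¹ P)
    θ⁻¹-resp : ∀ {P Q} → Y P → Y Q → P ≐ Q → θ⁻¹ P ≐ θ⁻¹ Q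
    θ⁻¹∘θ    : ∀ {A} → X A → θ⁻¹ (θ A) ≐ A
    θ∘θ⁻¹    : ∀ {P} → Y P → θ (θ⁻¹ P) ≐ P
    dist-X : ∀ {A B C} → X A → X B → X C →
             A ∩ θ⁻¹ (θ B ∪ θ C) ≐ θ⁻¹ (θ (A ∩ B) ∪ θ (A ∩ C))
    dist-Y : ∀ {P Q R} → Y P → Y Q → Y R →
             P ∪ θ (θ⁻¹ Q ∩ θ⁻¹ R) ≐ θ (θ⁻¹ (P ∪ Q) ∩ θ⁻¹ (P ∪ R))
    star-X      : ∀ {P} → Y P → X (star P)
    star-resp   : ∀ {P Q} → Y P → Y Q → P ≐ Q → star P ≐ star Q
    star⁻¹-Y    : ∀ {A} → X A → Y (star⁻¹ A)
    star⁻¹-resp : ∀ {A B} → X A → X B → A ≐ B → star⁻¹ A ≐ star⁻¹ B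
    star⁻¹∘star : ∀ {P} → Y P → star⁻¹ (star P) ≐ P
    star∘star⁻¹ : ∀ {A} → X A → star (star⁻¹ A) ≐ A
    star-antitone  : ∀ {P Q} → Y P → Y Q → P ⊆ Q → star Q ⊆ star P
    star-reflect   : ∀ {P Q} → Y P → Y Q → star Q ⊆ star P → P ⊆ Q
    star∘θ : ∀ {A} → X A → star (θ A) ≐ θ⁻¹ (star⁻¹ A)

record IsIsomorphism {a u v ℓ m : Level} {U : Set u} {V : Set v}
       (L : DeMorganBisemilattice a) (D : DDBSData U V ℓ m)
       (φ : DeMorganBisemilattice.Carrier L → Subset U ℓ)
       : Set (a ⊔ u ⊔ lsuc ℓ ⊔ m) where
  open DeMorganBisemilattice L
  open DDBSData D
  field
    φ-X    : ∀ x → X (φ x)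
    φ-onto : ∀ {A} → X A → ∃ λ x → φ x ≐ A
    φ-inj  : ∀ {x y} → φ x ≐ φ y → x ≡ y
    φ-∧    : ∀ x y → φ (x ∧ y) ≐ φ x · φ y
    φ-∨    : ∀ x y → φ (x ∨ y) ≐ φ x + φ y
    φ-′    : ∀ x → φ (x ′) ≐ (φ x) †
    φ-0    : φ 0# ≐ ⊥ₛ
    φ-1    : φ 1# ≐ ⊤ₛ

module Canonical {a : Level} (L : DeMorganBisemilattice a) where
  open DeMorganBisemilattice L

  ↑ : Carrier → Subset (Filter L) (lsuc a)
  ↑ x F = Lift (lsuc a) (Filter.P F x)

  ↓ : Carrier → Subset (Ideal L) (lsuc a)
  ↓ x I = Lift (lsuc a) (¬ Ideal.P I x)

  -- θ(↑x) = ↓x, θ⁻¹(↓x) = ↑x, (↓x)⋆ = ↑(x′), (↑x)⋆⁻¹ = ↓(x′),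
  -- each defined as the image along the defining relation.
  data' : DDBSData (Filter L) (Ideal L) (lsuc a) (lsuc a)
  data' = record
    { X      = λ S → ∃ λ x → S ≐ ↑ x
    ; Y      = λ P → ∃ λ x → P ≐ ↓ x
    ; θ      = λ S I → ∃ λ x → (S ≐ ↑ x) × ↓ x I
    ; θ⁻¹    = λ P F → ∃ λ x → (P ≐ ↓ x) × ↑ x F
    ; star   = λ P F → ∃ λ x → (P ≐ ↓ x) × ↑ (x ′) F
    ; star⁻¹ = λ S I → ∃ λ x → (S ≐ ↑ x) × ↓ (x ′) I
    ; 0̄      = ↓ 0#
    }

module Submission where

-- Every member of X is (extensionally) some ↑x and every member of Y some ↓x,
-- and x ↦ ↑x, x ↦ ↓x are injective.  Hence the relationally defined maps θ,
-- θ⁻¹, ⋆, ⋆⁻¹ act on representatives exactly as the paper prescribes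
-- (θ(↑x) = ↓x, (↓x)⋆ = ↑(x′), ...); this is the lemma `image-on` about images
-- along an injective labelling.  Each set-level axiom of a DDBS then reduces to
-- an identity of L:
--   * ↑(x ∧ y) = ↑x ∩ ↑y and ↓(x ∨ y) = ↓x ∪ ↓y (closure, distributivity),
--   * ↑ and ↓ preserve and reflect the orders ≤∧ resp. ≤∨ (injectivity, 0̄ least),
--   * x ≤∨ y ⇔ y′ ≤∧ x′ (⋆ is an inclusion-reversing order isomorphism).
-- Reflecting ≤∨ through ↓ and splitting ↓(x ∨ y) use excluded middle; the
-- statements about filters are constructive.

open import Defs
open import Level using (Level; _⊔_; Lift; lift; lower) renaming (suc to lsuc)
open import Function using (_∘_)
open import Data.Product using (_×_; _,_; ∃)
open import Data.Sum using (inj₁; inj₂; [_,_])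
open import Relation.Nullary using (yes; no)
open import Relation.Binary.Bundles using (Setoid)
open import Relation.Binary.PropositionalEquality using (_≡_; sym; trans; cong; subst; module ≡-Reasoning)
open import Axiom.ExcludedMiddle using (ExcludedMiddle)
open import Axiom.DoubleNegationElimination using (em⇒dne)
import Relation.Binary.Reasoning.Setoid as SetoidReasoning

module _ {u ℓ : Level} {U : Set u} where

  ≐-refl : {A : Subset U ℓ} → A ≐ A
  ≐-refl = (λ _ p → p) , (λ _ p → p)

  ≐-sym : {A B : Subset U ℓ} → A ≐ B → B ≐ A
  ≐-sym (A⊆B , B⊆A) = B⊆A , A⊆B

  ≐-trans : {A B C : Subset U ℓ} → A ≐ B → B ≐ C → A ≐ C
  ≐-trans (A⊆B , B⊆A) (B⊆C , C⊆B) = (λ z → B⊆C z ∘ A⊆B z) , (λ z → B⊆A z ∘ C⊆B z)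

  ≐-setoid : Setoid (u ⊔ lsuc ℓ) (u ⊔ ℓ)
  ≐-setoid = record
    { Carrier       = Subset U ℓ
    ; _≈_           = _≐_
    ; isEquivalence = record { refl = ≐-refl ; sym = ≐-sym ; trans = ≐-trans }
    }

  ∩-cong : {A A′ B B′ : Subset U ℓ} → A ≐ A′ → B ≐ B′ → A ∩ B ≐ A′ ∩ B′
  ∩-cong (f , f′) (g , g′) =
    (λ { z (p , q) → f z p , g z q }) , (λ { z (p , q) → f′ z p , g′ z q })

  ∪-cong : {A A′ B B′ : Subset U ℓ} → A ≐ A′ → B ≐ B′ → A ∪ B ≐ A′ ∪ B′
  ∪-cong (f , f′) (g , g′) =
    (λ z → [ inj₁ ∘ f z , inj₂ ∘ g z ]) , (λ z → [ inj₁ ∘ f′ z , inj₂ ∘ g′ z ])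

  ⊆-resp : {A A′ B B′ : Subset U ℓ} → A ≐ A′ → B ≐ B′ → A ⊆ B → A′ ⊆ B′
  ⊆-resp (_ , A′⊆A) (B⊆B′ , _) A⊆B z = B⊆B′ z ∘ A⊆B z ∘ A′⊆A z

-- The image of S
-- under G relates S to G y for every label y of S; when f is injective, S has
-- at most one label, so the image of a labelled set is G of its label.  The
-- maps θ, θ⁻¹, ⋆, ⋆⁻¹ of the canonical construction are all of this form.
module Image {c ℓ : Level} {C : Set c} {U : Set ℓ}
             (f : C → Subset U (c ⊔ ℓ))
             (f-injective : ∀ {x y} → f x ≐ f y → x ≡ y) where

  image : {V : Set ℓ} → (C → Subset V (c ⊔ ℓ)) → Subset U (c ⊔ ℓ) → Subset V (c ⊔ ℓ)
  image G S z = ∃ λ y → (S ≐ f y) × G y z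

  image-on : {V : Set ℓ} (G : C → Subset V (c ⊔ ℓ)) → ∀ {S x} → S ≐ f x → image G S ≐ G x
  image-on G S≐fx =
    (λ { z (y , S≐fy , Gyz) → subst (λ w → G w z) (f-injective (≐-trans (≐-sym S≐fy) S≐fx)) Gyz }) ,
    (λ z Gxz → _ , S≐fx , Gxz)

  image-resp : {V : Set ℓ} (G : C → Subset V (c ⊔ ℓ)) → ∀ {S T x} → S ≐ f x → S ≐ T → image G S ≐ image G T
  image-resp G S≐fx S≐T = ≐-trans (image-on G S≐fx) (≐-sym (image-on G (≐-trans (≐-sym S≐T) S≐fx)))

module Orders {a : Level} (L : DeMorganBisemilattice a) where
  open DeMorganBisemilattice L
  open ≡-Reasoning

  ≤∧-antisym : ∀ {x y} → x ≤∧ y → y ≤∧ x → x ≡ y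
  ≤∧-antisym {x} {y} x≤y y≤x = begin
    x     ≡⟨ sym x≤y ⟩
    x ∧ y ≡⟨ ∧-comm x y ⟩
    y ∧ x ≡⟨ y≤x ⟩
    y     ∎

  ≤∨-antisym : ∀ {x y} → x ≤∨ y → y ≤∨ x → x ≡ y
  ≤∨-antisym {x} {y} x≤y y≤x = begin
    x     ≡⟨ sym y≤x ⟩
    y ∨ x ≡⟨ ∨-comm y x ⟩
    x ∨ y ≡⟨ x≤y ⟩
    y     ∎

  ≤∧-trans : ∀ {x y z} → x ≤∧ y → y ≤∧ z → x ≤∧ z
  ≤∧-trans {x} {y} {z} x≤y y≤z = begin
    x ∧ z       ≡⟨ cong (_∧ z) (sym x≤y) ⟩
    (x ∧ y) ∧ z ≡⟨ ∧-assoc x y z ⟩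
    x ∧ (y ∧ z) ≡⟨ cong (x ∧_) y≤z ⟩
    x ∧ y       ≡⟨ x≤y ⟩
    x           ∎

  ≤∨-trans : ∀ {x y z} → x ≤∨ y → y ≤∨ z → x ≤∨ z
  ≤∨-trans {x} {y} {z} x≤y y≤z = begin
    x ∨ z       ≡⟨ cong (x ∨_) (sym y≤z) ⟩
    x ∨ (y ∨ z) ≡⟨ sym (∨-assoc x y z) ⟩
    (x ∨ y) ∨ z ≡⟨ cong (_∨ z) x≤y ⟩
    y ∨ z       ≡⟨ y≤z ⟩
    z           ∎

  ≤∧-meet : ∀ {x y z} → x ≤∧ y → x ≤∧ z → x ≤∧ (y ∧ z)
  ≤∧-meet {x} {y} {z} x≤y x≤z = begin
    x ∧ (y ∧ z) ≡⟨ sym (∧-assoc x y z) ⟩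
    (x ∧ y) ∧ z ≡⟨ cong (_∧ z) x≤y ⟩
    x ∧ z       ≡⟨ x≤z ⟩
    x           ∎

  ≤∨-join : ∀ {x y z} → x ≤∨ z → y ≤∨ z → (x ∨ y) ≤∨ z
  ≤∨-join {x} {y} {z} x≤z y≤z = begin
    (x ∨ y) ∨ z ≡⟨ ∨-assoc x y z ⟩
    x ∨ (y ∨ z) ≡⟨ cong (x ∨_) y≤z ⟩
    x ∨ z       ≡⟨ x≤z ⟩
    z           ∎

  ∧-lowerˡ : ∀ x y → (x ∧ y) ≤∧ x
  ∧-lowerˡ x y = begin
    (x ∧ y) ∧ x ≡⟨ ∧-assoc x y x ⟩
    x ∧ (y ∧ x) ≡⟨ cong (x ∧_) (∧-comm y x) ⟩
    x ∧ (x ∧ y) ≡⟨ sym (∧-assoc x x y) ⟩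
    (x ∧ x) ∧ y ≡⟨ cong (_∧ y) (∧-idem x) ⟩
    x ∧ y       ∎

  ∧-lowerʳ : ∀ x y → (x ∧ y) ≤∧ y
  ∧-lowerʳ x y = trans (∧-assoc x y y) (cong (x ∧_) (∧-idem y))

  ∨-upperˡ : ∀ x y → x ≤∨ (x ∨ y)
  ∨-upperˡ x y = trans (sym (∨-assoc x x y)) (cong (_∨ y) (∨-idem x))

  ∨-upperʳ : ∀ x y → y ≤∨ (x ∨ y)
  ∨-upperʳ x y = begin
    y ∨ (x ∨ y) ≡⟨ cong (y ∨_) (∨-comm x y) ⟩
    y ∨ (y ∨ x) ≡⟨ ∨-upperˡ y x ⟩
    y ∨ x       ≡⟨ ∨-comm y x ⟩
    x ∨ y       ∎

  0#-least : ∀ x → 0# ≤∨ x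
  0#-least x = trans (∨-comm 0# x) (∨-identity x)

  ′-antitone : ∀ {x y} → x ≤∨ y → (y ′) ≤∧ (x ′)
  ′-antitone {x} {y} x≤y = begin
    y ′ ∧ x ′ ≡⟨ ∧-comm (y ′) (x ′) ⟩
    x ′ ∧ y ′ ≡⟨ sym (deMorgan-∨ x y) ⟩
    (x ∨ y) ′ ≡⟨ cong _′ x≤y ⟩
    y ′       ∎

  ′-reflects : ∀ {x y} → (y ′) ≤∧ (x ′) → x ≤∨ y
  ′-reflects {x} {y} y′≤x′ = begin
    x ∨ y           ≡⟨ sym (′-invol (x ∨ y)) ⟩
    (x ∨ y) ′ ′     ≡⟨ cong _′ (trans (deMorgan-∨ x y) (∧-comm (x ′) (y ′))) ⟩
    (y ′ ∧ x ′) ′   ≡⟨ cong _′ y′≤x′ ⟩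
    y ′ ′           ≡⟨ ′-invol y ⟩
    y               ∎

  0′≡1 : 0# ′ ≡ 1#
  0′≡1 = begin
    0# ′              ≡⟨ sym (∧-identity (0# ′)) ⟩
    0# ′ ∧ 1#         ≡⟨ cong (0# ′ ∧_) (sym (′-invol 1#)) ⟩
    0# ′ ∧ 1# ′ ′     ≡⟨ sym (deMorgan-∨ 0# (1# ′)) ⟩
    (0# ∨ 1# ′) ′     ≡⟨ cong _′ (0#-least (1# ′)) ⟩
    1# ′ ′            ≡⟨ ′-invol 1# ⟩
    1#                ∎

module Principal {a : Level} (L : DeMorganBisemilattice a) where
  open DeMorganBisemilattice L
  open Orders L

  principal-filter : Carrier → Filter L
  principal-filter x = record
    { P = x ≤∧_ ; nonempty = x , ∧-idem x ; up = ≤∧-trans ; meet = ≤∧-meet }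

  principal-ideal : Carrier → Ideal L
  principal-ideal y = record
    { P = _≤∨ y ; nonempty = y , ∨-idem y ; down = λ w≤y z≤w → ≤∨-trans z≤w w≤y ; join = ≤∨-join }

module Representation {a : Level} (L : DeMorganBisemilattice a) where
  open DeMorganBisemilattice L
  open Canonical L
  open Orders L
  open Principal L

  ↑-monotone : ∀ {x y} → x ≤∧ y → ↑ x ⊆ ↑ y
  ↑-monotone x≤y F (lift x∈F) = lift (Filter.up F x∈F x≤y)

  -- the principal filter of x contains y exactly when x ≤∧ y
  ↑-reflects : ∀ {x y} → ↑ x ⊆ ↑ y → x ≤∧ y
  ↑-reflects {x} ↑x⊆↑y = lower (↑x⊆↑y (principal-filter x) (lift (∧-idem x)))

  ↑-injective : ∀ {x y} → ↑ x ≐ ↑ y → x ≡ y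
  ↑-injective (↑x⊆↑y , ↑y⊆↑x) = ≤∧-antisym (↑-reflects ↑x⊆↑y) (↑-reflects ↑y⊆↑x)

  ↑-∧ : ∀ {x y} → ↑ (x ∧ y) ≐ ↑ x ∩ ↑ y
  ↑-∧ {x} {y} =
    (λ F x∧y∈F → ↑-monotone (∧-lowerˡ x y) F x∧y∈F , ↑-monotone (∧-lowerʳ x y) F x∧y∈F) ,
    (λ { F (lift x∈F , lift y∈F) → lift (Filter.meet F x∈F y∈F) })

  ↓-monotone : ∀ {x y} → x ≤∨ y → ↓ x ⊆ ↓ y
  ↓-monotone x≤y I (lift x∉I) = lift (λ y∈I → x∉I (Ideal.down I y∈I x≤y))

  module Classical (lem : ExcludedMiddle (lsuc a)) where

    -- if x ≰∨ y then the principal ideal of y omits x but contains y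
    ↓-reflects : ∀ {x y} → ↓ x ⊆ ↓ y → x ≤∨ y
    ↓-reflects {x} {y} ↓x⊆↓y = lower (em⇒dne lem λ x≰y →
      lower (↓x⊆↓y (principal-ideal y) (lift (x≰y ∘ lift))) (∨-idem y))

    ↓-injective : ∀ {x y} → ↓ x ≐ ↓ y → x ≡ y
    ↓-injective (↓x⊆↓y , ↓y⊆↓x) = ≤∨-antisym (↓-reflects ↓x⊆↓y) (↓-reflects ↓y⊆↓x)

    -- an ideal omitting x ∨ y contains at most one of x and y, as it is ∨-closed
    ↓-∨ : ∀ {x y} → ↓ (x ∨ y) ≐ ↓ x ∪ ↓ y
    ↓-∨ {x} {y} = split , (λ I → [ ↓-monotone (∨-upperˡ x y) I , ↓-monotone (∨-upperʳ x y) I ])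
      where
        split : ↓ (x ∨ y) ⊆ ↓ x ∪ ↓ y
        split I (lift x∨y∉I) with lem {Lift (lsuc a) (Ideal.P I x)}
        ... | no x∉I         = inj₁ (lift (x∉I ∘ lift))
        ... | yes (lift x∈I) = inj₂ (lift (λ y∈I → x∨y∉I (Ideal.join I x∈I y∈I)))

module CanonicalDDBS {a : Level} (lem : ExcludedMiddle (lsuc a)) (L : DeMorganBisemilattice a) where
  open DeMorganBisemilattice L
  open Canonical L
  open DDBSData data'
  open Orders L
  open Representation L
  open Classical lem
  open Image ↑ ↑-injective using () renaming (image-on to along-↑; image-resp to along-↑-resp)
  open Image ↓ ↓-injective using () renaming (image-on to along-↓; image-resp to along-↓-resp)

  θ-on : ∀ {A x} → A ≐ ↑ x → θ A ≐ ↓ x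
  θ-on = along-↑ ↓

  θ⁻¹-on : ∀ {P x} → P ≐ ↓ x → θ⁻¹ P ≐ ↑ x
  θ⁻¹-on = along-↓ ↑

  star-on : ∀ {P x} → P ≐ ↓ x → star P ≐ ↑ (x ′)
  star-on = along-↓ (λ x → ↑ (x ′))

  star⁻¹-on : ∀ {A x} → A ≐ ↑ x → star⁻¹ A ≐ ↓ (x ′)
  star⁻¹-on = along-↑ (λ x → ↓ (x ′))

  ∩-on : ∀ {A B x y} → A ≐ ↑ x → B ≐ ↑ y → A ∩ B ≐ ↑ (x ∧ y)
  ∩-on A≐ B≐ = ≐-trans (∩-cong A≐ B≐) (≐-sym ↑-∧)

  ∪-on : ∀ {P Q x y} → P ≐ ↓ x → Q ≐ ↓ y → P ∪ Q ≐ ↓ (x ∨ y)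
  ∪-on P≐ Q≐ = ≐-trans (∪-cong P≐ Q≐) (≐-sym ↓-∨)

  +-on : ∀ {A B x y} → A ≐ ↑ x → B ≐ ↑ y → A + B ≐ ↑ (x ∨ y)
  +-on A≐ B≐ = θ⁻¹-on (∪-on (θ-on A≐) (θ-on B≐))

  θ-∩-on : ∀ {P Q x y} → P ≐ ↓ x → Q ≐ ↓ y → θ (θ⁻¹ P ∩ θ⁻¹ Q) ≐ ↓ (x ∧ y)
  θ-∩-on P≐ Q≐ = θ-on (∩-on (θ⁻¹-on P≐) (θ⁻¹-on Q≐))

  dist-X : ∀ {A B C x y z} → A ≐ ↑ x → B ≐ ↑ y → C ≐ ↑ z →
           A ∩ (B + C) ≐ (A ∩ B) + (A ∩ C)
  dist-X {A} {B} {C} {x} {y} {z} A≐ B≐ C≐ = begin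
    A ∩ (B + C)             ≈⟨ ∩-on A≐ (+-on B≐ C≐) ⟩
    ↑ (x ∧ (y ∨ z))         ≡⟨ cong ↑ (∧-distrib-∨ x y z) ⟩
    ↑ ((x ∧ y) ∨ (x ∧ z))   ≈⟨ ≐-sym (+-on (∩-on A≐ B≐) (∩-on A≐ C≐)) ⟩
    (A ∩ B) + (A ∩ C)       ∎
    where open SetoidReasoning ≐-setoid

  dist-Y : ∀ {P Q R x y z} → P ≐ ↓ x → Q ≐ ↓ y → R ≐ ↓ z →
           P ∪ θ (θ⁻¹ Q ∩ θ⁻¹ R) ≐ θ (θ⁻¹ (P ∪ Q) ∩ θ⁻¹ (P ∪ R))
  dist-Y {P} {Q} {R} {x} {y} {z} P≐ Q≐ R≐ = begin
    P ∪ θ (θ⁻¹ Q ∩ θ⁻¹ R)               ≈⟨ ∪-on P≐ (θ-∩-on Q≐ R≐) ⟩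
    ↓ (x ∨ (y ∧ z))                     ≡⟨ cong ↓ (∨-distrib-∧ x y z) ⟩
    ↓ ((x ∨ y) ∧ (x ∨ z))               ≈⟨ ≐-sym (θ-∩-on (∪-on P≐ Q≐) (∪-on P≐ R≐)) ⟩
    θ (θ⁻¹ (P ∪ Q) ∩ θ⁻¹ (P ∪ R))       ∎
    where open SetoidReasoning ≐-setoid

  -- ⋆ reverses and reflects inclusion because ′ exchanges ≤∨ and ≤∧
  star-antitone : ∀ {P Q x y} → P ≐ ↓ x → Q ≐ ↓ y → P ⊆ Q → star Q ⊆ star P
  star-antitone P≐ Q≐ P⊆Q =
    ⊆-resp (≐-sym (star-on Q≐)) (≐-sym (star-on P≐))
      (↑-monotone (′-antitone (↓-reflects (⊆-resp P≐ Q≐ P⊆Q))))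

  star-reflect : ∀ {P Q x y} → P ≐ ↓ x → Q ≐ ↓ y → star Q ⊆ star P → P ⊆ Q
  star-reflect P≐ Q≐ ⋆Q⊆⋆P =
    ⊆-resp (≐-sym P≐) (≐-sym Q≐)
      (↓-monotone (′-reflects (↑-reflects (⊆-resp (star-on Q≐) (star-on P≐) ⋆Q⊆⋆P))))

  star⁻¹∘star-on : ∀ {P x} → P ≐ ↓ x → star⁻¹ (star P) ≐ P
  star⁻¹∘star-on {P} {x} P≐ = begin
    star⁻¹ (star P) ≈⟨ star⁻¹-on (star-on P≐) ⟩
    ↓ (x ′ ′)       ≡⟨ cong ↓ (′-invol x) ⟩
    ↓ x             ≈⟨ ≐-sym P≐ ⟩
    P               ∎
    where open SetoidReasoning ≐-setoid

  star∘star⁻¹-on : ∀ {A x} → A ≐ ↑ x → star (star⁻¹ A) ≐ A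
  star∘star⁻¹-on {A} {x} A≐ = begin
    star (star⁻¹ A) ≈⟨ star-on (star⁻¹-on A≐) ⟩
    ↑ (x ′ ′)       ≡⟨ cong ↑ (′-invol x) ⟩
    ↑ x             ≈⟨ ≐-sym A≐ ⟩
    A               ∎
    where open SetoidReasoning ≐-setoid

  isDDBS : IsDDBSofSets data'
  isDDBS = record
    { X-resp        = λ { A≐B (x , A≐) → x , ≐-trans (≐-sym A≐B) A≐ }
    ; Y-resp        = λ { P≐Q (x , P≐) → x , ≐-trans (≐-sym P≐Q) P≐ }
    ; X-∩           = λ { (x , A≐) (y , B≐) → x ∧ y , ∩-on A≐ B≐ }
    ; Y-∪           = λ { (x , P≐) (y , Q≐) → x ∨ y , ∪-on P≐ Q≐ }
    ; Y-0̄           = 0# , ≐-refl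
    ; 0̄-least       = λ { (x , P≐) → ⊆-resp ≐-refl (≐-sym P≐) (↓-monotone (0#-least x)) }
    ; θ-Y           = λ { (x , A≐) → x , θ-on A≐ }
    ; θ-resp        = λ { (_ , A≐) _ → along-↑-resp ↓ A≐ }
    ; θ⁻¹-X         = λ { (x , P≐) → x , θ⁻¹-on P≐ }
    ; θ⁻¹-resp      = λ { (_ , P≐) _ → along-↓-resp ↑ P≐ }
    ; θ⁻¹∘θ         = λ { (_ , A≐) → ≐-trans (θ⁻¹-on (θ-on A≐)) (≐-sym A≐) }
    ; θ∘θ⁻¹         = λ { (_ , P≐) → ≐-trans (θ-on (θ⁻¹-on P≐)) (≐-sym P≐) }
    ; dist-X        = λ { (_ , A≐) (_ , B≐) (_ , C≐) → dist-X A≐ B≐ C≐ }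
    ; dist-Y        = λ { (_ , P≐) (_ , Q≐) (_ , R≐) → dist-Y P≐ Q≐ R≐ }
    ; star-X        = λ { (x , P≐) → x ′ , star-on P≐ }
    ; star-resp     = λ { (_ , P≐) _ → along-↓-resp (λ x → ↑ (x ′)) P≐ }
    ; star⁻¹-Y      = λ { (x , A≐) → x ′ , star⁻¹-on A≐ }
    ; star⁻¹-resp   = λ { (_ , A≐) _ → along-↑-resp (λ x → ↓ (x ′)) A≐ }
    ; star⁻¹∘star   = λ { (_ , P≐) → star⁻¹∘star-on P≐ }
    ; star∘star⁻¹   = λ { (_ , A≐) → star∘star⁻¹-on A≐ }
    ; star-antitone = λ { (_ , P≐) (_ , Q≐) → star-antitone P≐ Q≐ }
    ; star-reflect  = λ { (_ , P≐) (_ , Q≐) → star-reflect P≐ Q≐ }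
    ; star∘θ        = λ { (_ , A≐) → ≐-trans (star-on (θ-on A≐)) (≐-sym (θ⁻¹-on (star⁻¹-on A≐))) }
    }

  isIsomorphism : IsIsomorphism L data' ↑
  isIsomorphism = record
    { φ-X    = λ x → x , ≐-refl
    ; φ-onto = λ { (x , A≐) → x , ≐-sym A≐ }
    ; φ-inj  = ↑-injective
    ; φ-∧    = λ x y → ↑-∧
    ; φ-∨    = λ x y → ≐-sym (+-on ≐-refl ≐-refl)
    ; φ-′    = λ x → ≐-sym (star-on (θ-on ≐-refl))
    ; φ-0    = ≐-sym (θ⁻¹-on ≐-refl)
    ; φ-1    = subst (λ t → ↑ t ≐ ⊤ₛ) 0′≡1 (≐-sym (star-on ≐-refl))
    }

theorem4p2 : ∀ {a} → ExcludedMiddle (lsuc a) → (L : DeMorganBisemilattice a) →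
    let open DeMorganBisemilattice L
        open Canonical L
        open DDBSData data'
    in ((∀ x → θ (↑ x) ≐ ↓ x) × (∀ x → θ⁻¹ (↓ x) ≐ ↑ x)
        × (∀ x → star (↓ x) ≐ ↑ (x ′)) × (∀ x → star⁻¹ (↑ x) ≐ ↓ (x ′)))
       × IsDDBSofSets data'
       × IsIsomorphism L data' ↑
theorem4p2 lem L =
  ( ( (λ _ → θ-on ≐-refl) , (λ _ → θ⁻¹-on ≐-refl)
    , (λ _ → star-on ≐-refl) , (λ _ → star⁻¹-on ≐-refl) )
  , isDDBS
  , isIsomorphism )
  where open CanonicalDDBS lem L
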